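{- Let $n,k$ be positive integers with $n \geq 3(n-k)$ and $n \geq k$, and let $C$ be a linear chord diagram with $n$ chords in which every chord has length at least $k$. Let $M_{n,k}=\{k+1,k+2,\dots,2n-k\}$ and let $C_{n,k}$ be the set of chords $c$ of $C$ with $s_c \in M_{n,k}$ or $e_c\in M_{n,k}$. Then $C_{n,k}$ contains exactly $n-k$ chords whose start point lies in $M_{n,k}$ and exactly $n-k$ chords whose end point lies in $M_{n,k}$.
   Context: A linear chord diagram with $n$ chords is a partition of $\{1,2,\dots,2n\}$ into blocks of size two, called chords. For a chord $c=\{s_c,e_c\}$ with $s_c<e_c$, $s_c$ is its start point, $e_c$ its end point, and its length is $e_c-s_c$. -}

module Defs where

open import Data.Nat using (ℕ; zero; suc; _+_; _*_; _∸_; _≤_; _<_; _≤?_)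
open import Data.Nat.Properties using (_<?_)
open import Data.Product using (_×_; _,_; proj₁; proj₂)
open import Data.Sum using (_⊎_)
open import Data.List using (List; []; _∷_; length; filter; concatMap; map)
open import Data.List.Relation.Unary.All using (All)
open import Data.List.Relation.Binary.Permutation.Propositional using (_↭_)
open import Relation.Nullary using (Dec)
open import Relation.Nullary.Decidable using (_×-dec_; _⊎-dec_)
open import Relation.Binary.PropositionalEquality using (_≡_)

Chord : Set
Chord = ℕ × ℕ

start : Chord → ℕ
start = proj₁

end : Chord → ℕ
end = proj₂

len : Chord → ℕ
len c = end c ∸ start c

range : ℕ → ℕ → List ℕ
range a zero = []
range a (suc m) = a ∷ range (suc a) m

points : List Chord → List ℕ
points = concatMap (λ c → start c ∷ end c ∷ [])

-- C is a linear chord diagram with n chords: n chords, each with s < e,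
-- and the endpoints form exactly the set {1, ..., 2n}, each used once
-- (i.e. the chords partition {1,...,2n} into blocks of size two).
IsChordDiagram : ℕ → List Chord → Set
IsChordDiagram n C =
  (length C ≡ n) × (All (λ c → start c < end c) C × (points C ↭ range 1 (2 * n)))

InM : ℕ → ℕ → ℕ → Set
InM n k x = (k + 1 ≤ x) × (x ≤ 2 * n ∸ k)

inM? : ∀ n k x → Dec (InM n k x)
inM? n k x = (k + 1 ≤? x) ×-dec (x ≤? 2 * n ∸ k)

Cnk : ℕ → ℕ → List Chord → List Chord
Cnk n k C = filter (λ c → inM? n k (start c) ⊎-dec inM? n k (end c)) C

#startsIn : ℕ → ℕ → List Chord → ℕ
#startsIn n k D = length (filter (λ c → inM? n k (start c)) D)

#endsIn : ℕ → ℕ → List Chord → ℕ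
#endsIn n k D = length (filter (λ c → inM? n k (end c)) D)

module Submission where

-- The endpoints of a chord diagram with n chords are exactly
-- 1, ..., 2n, each used once.  Hence for every threshold t ≤ 2n the points
-- ≤ t are split between start points and end points:
--     #{c | s_c ≤ t} + #{c | e_c ≤ t} = t                 (points-below)
-- If every chord has length ≥ k then every end point exceeds k and every
-- start point is at most 2n - k.  Taking t = k, no end point is ≤ k, so
-- exactly k start points are ≤ k and the remaining n - k lie in M_{n,k}.
-- Taking t = 2n - k, all n start points are ≤ 2n - k, so exactly n - k end
-- points are ≤ 2n - k, and these are precisely the end points in M_{n,k}.
-- Finally a chord whose start (end) lies in M_{n,k} belongs to C_{n,k}, so
-- counting inside C_{n,k} is the same as counting inside C.

open import Defs
open import Data.Nat using (ℕ; zero; suc; _+_; _*_; _∸_; _≤_; _<_; _≤?_; s≤s; z<s)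
open import Data.Nat.Properties
open import Data.Product using (_×_; _,_; proj₂)
open import Data.Sum using (inj₁; inj₂)
open import Data.List using (List; []; _∷_; length; filter)
open import Data.List.Properties using (filter-all; filter-none; filter-accept; filter-reject)
open import Data.List.Relation.Unary.All as All using (All; []; _∷_)
open import Data.List.Relation.Binary.Permutation.Propositional using (_↭_; ↭-sym)
open import Data.List.Relation.Binary.Permutation.Propositional.Properties
  using (↭-length; filter-↭; All-resp-↭)
open import Relation.Nullary using (yes; no; ¬_; contradiction)
open import Relation.Unary using (Pred; Decidable)
open import Relation.Unary.Properties using (∁?)
open import Relation.Binary.PropositionalEquality
open import Function using (_∘_)
open import Level using (Level)

private
  variable
    a p q : Level
    A : Set a

length-filter-∁ : {P : Pred A p} (P? : Decidable P) (xs : List A) →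
  length (filter P? xs) + length (filter (∁? P?) xs) ≡ length xs
length-filter-∁ P? [] = refl
length-filter-∁ P? (x ∷ xs) with P? x
... | yes _ = cong suc (length-filter-∁ P? xs)
... | no _  = trans (+-suc _ _) (cong suc (length-filter-∁ P? xs))

filter-cong-All : {P : Pred A p} {Q : Pred A q} (P? : Decidable P) (Q? : Decidable Q)
  {xs : List A} → All (λ x → (P x → Q x) × (Q x → P x)) xs →
  filter P? xs ≡ filter Q? xs
filter-cong-All P? Q? [] = refl
filter-cong-All P? Q? {x ∷ xs} ((P⇒Q , Q⇒P) ∷ agree) with P? x
... | yes Px = trans (cong (x ∷_) (filter-cong-All P? Q? agree))
                     (sym (filter-accept Q? (P⇒Q Px)))
... | no ¬Px = trans (filter-cong-All P? Q? agree)
                     (sym (filter-reject Q? (¬Px ∘ Q⇒P)))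

filter-∷-cong : {P : Pred A p} (P? : Decidable P) (x : A) {ys zs : List A} →
  filter P? ys ≡ filter P? zs → filter P? (x ∷ ys) ≡ filter P? (x ∷ zs)
filter-∷-cong P? x eq with P? x
... | yes _ = cong (x ∷_) eq
... | no _  = eq

filter-absorb : {P : Pred A p} {Q : Pred A q} (P? : Decidable P) (Q? : Decidable Q) →
  (∀ {x} → P x → Q x) → (xs : List A) → filter P? (filter Q? xs) ≡ filter P? xs
filter-absorb P? Q? P⇒Q [] = refl
filter-absorb P? Q? P⇒Q (x ∷ xs) with Q? x
... | yes _  = filter-∷-cong P? x (filter-absorb P? Q? P⇒Q xs)
... | no ¬Qx = trans (filter-absorb P? Q? P⇒Q xs) (sym (filter-reject P? (¬Qx ∘ P⇒Q)))

range-bounds : (a L : ℕ) → All (λ x → a ≤ x × x < a + L) (range a L)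
range-bounds a zero    = []
range-bounds a (suc L) = (≤-refl , m<m+n a z<s) ∷ All.map widen (range-bounds (suc a) L)
  where
    widen : ∀ {x} → suc a ≤ x × x < suc a + L → a ≤ x × x < a + suc L
    widen {x} (a<x , x<) = <⇒≤ a<x , subst (x <_) (sym (+-suc a L)) x<

count-range-below : (b t L : ℕ) → t ≤ L →
  length (filter (_≤? b + t) (range (suc b) L)) ≡ t
count-range-below b zero L _ =
  cong length (filter-none (_≤? b + 0) (All.map above (range-bounds (suc b) L)))
  where
    above : ∀ {x} → b < x × x < suc b + L → ¬ x ≤ b + 0
    above {x} (b<x , _) x≤b = <⇒≱ b<x (subst (x ≤_) (+-identityʳ b) x≤b)
count-range-below b (suc t) (suc L) (s≤s t≤L) = begin
    length (filter (_≤? b + suc t) (suc b ∷ range (suc (suc b)) L))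
  ≡⟨ cong length (filter-accept (_≤? b + suc t) (m<m+n b z<s)) ⟩
    suc (length (filter (_≤? b + suc t) (range (suc (suc b)) L)))
  ≡⟨ cong (λ m → suc (length (filter (_≤? m) (range (suc (suc b)) L)))) (+-suc b t) ⟩
    suc (length (filter (_≤? suc b + t) (range (suc (suc b)) L)))
  ≡⟨ cong suc (count-range-below (suc b) t L t≤L) ⟩
    suc t ∎
  where open ≡-Reasoning

count-range : (t L : ℕ) → t ≤ L → length (filter (_≤? t) (range 1 L)) ≡ t
count-range = count-range-below 0

count-points : {P : Pred ℕ p} (P? : Decidable P) (C : List Chord) →
  length (filter P? (points C)) ≡
  length (filter (P? ∘ start) C) + length (filter (P? ∘ end) C)
count-points P? [] = refl
count-points P? (c ∷ C) with P? (start c)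
... | yes _ with P? (end c)
...   | yes _ = cong suc (trans (cong suc (count-points P? C)) (sym (+-suc _ _)))
...   | no _  = cong suc (count-points P? C)
count-points P? (c ∷ C) | no _ with P? (end c)
...   | yes _ = trans (cong suc (count-points P? C)) (sym (+-suc _ _))
...   | no _  = count-points P? C

All-points : {P : Pred ℕ p} (C : List Chord) → All P (points C) →
  All (λ c → P (start c) × P (end c)) C
All-points [] [] = []
All-points (c ∷ C) (Ps ∷ Pe ∷ Prest) = (Ps , Pe) ∷ All-points C Prest

#startsAtMost : ℕ → List Chord → ℕ
#startsAtMost t C = length (filter (λ c → start c ≤? t) C)

#endsAtMost : ℕ → List Chord → ℕ
#endsAtMost t C = length (filter (λ c → end c ≤? t) C)

-- The basic counting principle: the points 1, ..., t of a diagram with n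
-- chords are exactly the start and end points that are at most t.
points-below : (n t : ℕ) (C : List Chord) → IsChordDiagram n C → t ≤ 2 * n →
  #startsAtMost t C + #endsAtMost t C ≡ t
points-below n t C (_ , _ , points↭range) t≤2n = begin
    #startsAtMost t C + #endsAtMost t C
  ≡⟨ count-points (_≤? t) C ⟨
    length (filter (_≤? t) (points C))
  ≡⟨ ↭-length (filter-↭ (_≤? t) points↭range) ⟩
    length (filter (_≤? t) (range 1 (2 * n)))
  ≡⟨ count-range t (2 * n) t≤2n ⟩
    t ∎
  where open ≡-Reasoning

diagram-bounds : (n : ℕ) (C : List Chord) → IsChordDiagram n C →
  All (λ c → 1 ≤ start c × end c ≤ 2 * n) C
diagram-bounds n C (_ , _ , points↭range) =
  All.map (λ ((1≤s , _) , (_ , e<)) → 1≤s , ≤-pred e<)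
    (All-points C (All-resp-↭ (↭-sym points↭range) (range-bounds 1 (2 * n))))

Spread : ℕ → ℕ → Chord → Set
Spread N k c = (k < end c) × (start c ≤ N ∸ k)

long-chord-spread : (N k : ℕ) (c : Chord) → 1 ≤ start c × end c ≤ N →
  start c < end c → k ≤ len c → Spread N k c
long-chord-spread N k c (1≤s , e≤N) s<e k≤len =
  ≤-trans (+-monoˡ-≤ k 1≤s) s+k≤e , m+n≤o⇒m≤o∸n (start c) (≤-trans s+k≤e e≤N)
  where
    s+k≤e : start c + k ≤ end c
    s+k≤e = subst (start c + k ≤_) (m+[n∸m]≡n (<⇒≤ s<e)) (+-monoʳ-≤ (start c) k≤len)

diagram-spread : (n k : ℕ) (C : List Chord) → IsChordDiagram n C →
  All (λ c → k ≤ len c) C → All (Spread (2 * n) k) C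
diagram-spread n k C D@(_ , ordered , _) long =
  All.zipWith (λ {c} ((bounds , s<e) , k≤len) → long-chord-spread (2 * n) k c bounds s<e k≤len)
    (All.zip (diagram-bounds n C D , ordered) , long)

m+n≡o⇒n≡o∸m : (m n o : ℕ) → m + n ≡ o → n ≡ o ∸ m
m+n≡o⇒n≡o∸m m n o eq = trans (sym (m+n∸m≡n m n)) (cong (_∸ m) eq)

[2n∸k]∸n≡n∸k : (n k : ℕ) → 2 * n ∸ k ∸ n ≡ n ∸ k
[2n∸k]∸n≡n∸k n k = begin
    2 * n ∸ k ∸ n          ≡⟨ ∸-+-assoc (2 * n) k n ⟩
    2 * n ∸ (k + n)        ≡⟨ cong (2 * n ∸_) (+-comm k n) ⟩
    n + (n + 0) ∸ (n + k)  ≡⟨ [m+n]∸[m+o]≡n∸o n (n + 0) k ⟩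
    n + 0 ∸ k              ≡⟨ cong (_∸ k) (+-identityʳ n) ⟩
    n ∸ k ∎
  where open ≡-Reasoning

-- Exactly k chords start among the first k points, since none ends there.
#startsAtMost-k : (n k : ℕ) (C : List Chord) → IsChordDiagram n C →
  All (Spread (2 * n) k) C → k ≤ 2 * n → #startsAtMost k C ≡ k
#startsAtMost-k n k C D spread k≤2n = begin
    #startsAtMost k C                     ≡⟨ +-identityʳ _ ⟨
    #startsAtMost k C + 0                 ≡⟨ cong (#startsAtMost k C +_) noEnds ⟨
    #startsAtMost k C + #endsAtMost k C   ≡⟨ points-below n k C D k≤2n ⟩
    k ∎
  where
    open ≡-Reasoning
    noEnds : #endsAtMost k C ≡ 0
    noEnds = cong length (filter-none (λ c → end c ≤? k) (All.map (λ (k<e , _) → <⇒≱ k<e) spread))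

-- Exactly n - k chords end among the first 2n - k points, since all n
-- chords start there.
#endsAtMost-2n∸k : (n k : ℕ) (C : List Chord) → IsChordDiagram n C →
  All (Spread (2 * n) k) C → #endsAtMost (2 * n ∸ k) C ≡ n ∸ k
#endsAtMost-2n∸k n k C D@(length≡n , _) spread = begin
    #endsAtMost t C      ≡⟨ m+n≡o⇒n≡o∸m n _ t (trans (cong (_+ #endsAtMost t C) allStarts)
                                                     (points-below n t C D (m∸n≤m (2 * n) k))) ⟩
    t ∸ n                ≡⟨ [2n∸k]∸n≡n∸k n k ⟩
    n ∸ k ∎
  where
    open ≡-Reasoning
    t = 2 * n ∸ k
    allStarts : n ≡ #startsAtMost t C
    allStarts = trans (sym length≡n)
      (sym (cong length (filter-all (λ c → start c ≤? t) (All.map proj₂ spread))))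

start-in-M : (n k : ℕ) (c : Chord) → Spread (2 * n) k c →
  (InM n k (start c) → ¬ start c ≤ k) × (¬ start c ≤ k → InM n k (start c))
start-in-M n k c (_ , s≤2n∸k) =
  (λ (k+1≤s , _) → <⇒≱ (subst (_≤ start c) (+-comm k 1) k+1≤s)) ,
  (λ s≰k → subst (_≤ start c) (+-comm 1 k) (≰⇒> s≰k) , s≤2n∸k)

end-in-M : (n k : ℕ) (c : Chord) → Spread (2 * n) k c →
  (InM n k (end c) → end c ≤ 2 * n ∸ k) × (end c ≤ 2 * n ∸ k → InM n k (end c))
end-in-M n k c (k<e , _) = proj₂ , (λ e≤2n∸k → subst (_≤ end c) (+-comm 1 k) k<e , e≤2n∸k)

#starts-in-M : (n k : ℕ) (C : List Chord) → IsChordDiagram n C →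
  All (Spread (2 * n) k) C → k ≤ 2 * n →
  length (filter (λ c → inM? n k (start c)) C) ≡ n ∸ k
#starts-in-M n k C D@(length≡n , _) spread k≤2n = begin
    length (filter (λ c → inM? n k (start c)) C)
  ≡⟨ cong length (filter-cong-All _ (∁? (λ c → start c ≤? k)) (All.map (start-in-M n k _) spread)) ⟩
    #startsAbove
  ≡⟨ m+n≡o⇒n≡o∸m k _ n split ⟩
    n ∸ k ∎
  where
    open ≡-Reasoning
    #startsAbove : ℕ
    #startsAbove = length (filter (∁? (λ c → start c ≤? k)) C)
    split : k + #startsAbove ≡ n
    split = begin
      k + #startsAbove
        ≡⟨ cong (_+ #startsAbove) (#startsAtMost-k n k C D spread k≤2n) ⟨
      #startsAtMost k C + #startsAbove
        ≡⟨ length-filter-∁ (λ c → start c ≤? k) C ⟩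
      length C
        ≡⟨ length≡n ⟩
      n ∎

#ends-in-M : (n k : ℕ) (C : List Chord) → IsChordDiagram n C →
  All (Spread (2 * n) k) C → length (filter (λ c → inM? n k (end c)) C) ≡ n ∸ k
#ends-in-M n k C D spread =
  trans (cong length (filter-cong-All _ (λ c → end c ≤? 2 * n ∸ k) (All.map (end-in-M n k _) spread)))
        (#endsAtMost-2n∸k n k C D spread)

#startsIn-Cnk : (n k : ℕ) (C : List Chord) →
  #startsIn n k (Cnk n k C) ≡ length (filter (λ c → inM? n k (start c)) C)
#startsIn-Cnk n k C = cong length (filter-absorb _ _ inj₁ C)

#endsIn-Cnk : (n k : ℕ) (C : List Chord) →
  #endsIn n k (Cnk n k C) ≡ length (filter (λ c → inM? n k (end c)) C)
#endsIn-Cnk n k C = cong length (filter-absorb _ _ inj₂ C)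

-- The theorem: every chord is k-spread, so the counts above apply.
lemma2 : (n k : ℕ) → 0 < n → 0 < k → 3 * (n ∸ k) ≤ n → k ≤ n →
    (C : List Chord) → IsChordDiagram n C → All (λ c → k ≤ len c) C →
    (#startsIn n k (Cnk n k C) ≡ n ∸ k) × (#endsIn n k (Cnk n k C) ≡ n ∸ k)
lemma2 n k _ _ _ k≤n C D long =
  trans (#startsIn-Cnk n k C) (#starts-in-M n k C D spread k≤2n) ,
  trans (#endsIn-Cnk n k C) (#ends-in-M n k C D spread)
  where
    spread : All (Spread (2 * n) k) C
    spread = diagram-spread n k C D long
    k≤2n : k ≤ 2 * n
    k≤2n = m≤n⇒m≤n+o (n + 0) k≤n
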